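{- Let $T$ be an increasing balanced path diagram with arrows $A_1,\dots,A_N$, and run Step 2 of Algorithm $\mathrm{HPath}^{\phi_k^{ -1}}$ on $T$. Suppose Step 2 stops early with no unlabelled arrow found, the labelled arrows being $A_{\pi(1)},\dots,A_{\pi(i)}$ with $i<N$. Then $(b_{\pi(1)},\dots,b_{\pi(i)})$, obtained by horizontally shifting (concatenating) the labelled arrows, is a general Dyck path; the path diagram formed by the labelled arrows is balanced, and the path diagram formed by the unlabelled arrows (at their current ranks) is also balanced.
   Context: A path diagram $T(P,R)$, $P=(b_1,\dots,b_N)$, $R=(r_1,\dots,r_N)$, consists of arrows $A_i=(1,b_i)$ starting at $(i,r_i)$ and ending at level $r_i+b_i$ (end rank). Red arrow: $b_i>0$, with a segment in row $j$ (strip between heights $j,j+1$) iff $r_i\le j\le r_i+b_i-1$; blue: $b_i<0$, segment in row $j$ iff $r_i+b_i\le j\le r_i-1$. Row count $c(j)$ = #red segments minus #blue segments in row $j$; balanced means all $c(j)=0$ (this notion applies to any collection of arrows with given ranks); increasing means $r_1\le\dots\le r_N$. A general Dyck path is an integer sequence with total sum $0$ and all partial sums $b_1+\dots+b_{i-1}\ge0$. Fix $\phi=(\phi_1,\phi_2,\dots)$, $\phi_i\in\mathfrak S_i$. Algorithm $\mathrm{HPath}^{\phi_k^{ -1}}$ on input an increasing balanced $T$: Step 1: set the current level to $0$ and a counter $\mathfrak n=0$; let $k$ be the number of arrows of the current $T$ starting at level $0$. Step 2: for $i=1,\dots,N$: if the current level is $0$, set $\mathfrak n=\mathfrak n+1$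 and let $A_j$ be the $\phi_k^{ -1}(\mathfrak n)$-th arrow, from left to right, among those starting at level $0$; otherwise let $A_j$ be the rightmost unlabelled arrow starting at the current level. If no such $j$ exists, go to Step 3; otherwise label $A_j$ by $i$, set $\pi(i)=j$, and set the current level to the end rank of $A_j$. Step 3: shift all unlabelled arrows one level down (decrease their ranks by $1$), erase all labels, and go to Step 1. Step 4 (reached when all $N$ arrows are labelled in Step 2): output $(b_{\pi(1)},\dots,b_{\pi(N)})$. -}

module Defs where

open import Data.Bool using (Bool; true; false; if_then_else_; _∧_)
open import Data.Nat as ℕ using (ℕ; zero; suc)
open import Data.Integer as ℤ using (ℤ; +_; 0ℤ; 1ℤ; -1ℤ)
open import Data.Fin as Fin using (Fin)
open import Data.Fin.Permutation using (Permutation′; _⟨$⟩ˡ_)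
open import Data.List using (List; []; _∷_; _++_; [_]; map; filter; length; lookup; last; take; foldr; allFin)
open import Data.Maybe using (Maybe; just; nothing)
open import Data.Product using (_×_)
open import Relation.Nullary using (does; ¬?; yes; no; _×-dec_)
open import Relation.Binary.PropositionalEquality using (_≡_)
import Data.List.Membership.DecPropositional as DecMem

-- Path diagrams T(P,R): N arrows, arrow A_i = (1, b_i) starting at (i, r_i).
-- Ranks r_i are natural numbers (levels ≥ 0), steps b_i are integers.

sumℤ : List ℤ → ℤ
sumℤ = foldr ℤ._+_ 0ℤ

record Arrow : Set where
  constructor arrow
  field
    step : ℤ
    rank : ℕ
open Arrow public

PathDiagram : ℕ → Set
PathDiagram N = Fin N → Arrow

endRank : Arrow → ℤ
endRank a = + rank a ℤ.+ step a

Increasing : ∀ {N} → PathDiagram N → Set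
Increasing {N} T = ∀ (i j : Fin N) → i Fin.≤ j → rank (T i) ℕ.≤ rank (T j)

-- Contribution of one arrow to the row count c(j) of row j
-- (strip between heights j and j+1):
--   +1 if red (b > 0) with r ≤ j ≤ r + b - 1,
--   -1 if blue (b < 0) with r + b ≤ j ≤ r - 1, 0 otherwise.
rowContribution : Arrow → ℤ → ℤ
rowContribution a j =
  if does (0ℤ ℤ.<? b) ∧ does (r ℤ.≤? j) ∧ does (j ℤ.≤? (r ℤ.+ b ℤ.- 1ℤ))
  then 1ℤ
  else (if does (b ℤ.<? 0ℤ) ∧ does ((r ℤ.+ b) ℤ.≤? j) ∧ does (j ℤ.≤? (r ℤ.- 1ℤ))
        then -1ℤ
        else 0ℤ)
  where
    b = step a
    r = + rank a

rowCount : ∀ {N} → PathDiagram N → List (Fin N) → ℤ → ℤ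
rowCount T S j = sumℤ (map (λ i → rowContribution (T i) j) S)

BalancedOn : ∀ {N} → PathDiagram N → List (Fin N) → Set
BalancedOn {N} T S = ∀ (j : ℤ) → rowCount T S j ≡ 0ℤ

Balanced : ∀ {N} → PathDiagram N → Set
Balanced {N} T = BalancedOn T (allFin N)

GeneralDyck : List ℤ → Set
GeneralDyck xs = (sumℤ xs ≡ 0ℤ) × (∀ (m : ℕ) → 0ℤ ℤ.≤ sumℤ (take m xs))

-- Step 2 of Algorithm HPath^{φ_k^{-1}}, run on T starting from Step 1
-- (current level 0, counter 0).  φ k is a permutation of Fin k
-- (0-based version of φ_k ∈ 𝔖_k; φ 0 is irrelevant).

module Step2 {N : ℕ} (T : PathDiagram N) (φ : (k : ℕ) → Permutation′ k) where

  open DecMem (Fin._≟_ {N}) using (_∈?_)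

  level0 : List (Fin N)
  level0 = filter (λ j → rank (T j) ℕ.≟ 0) (allFin N)

  k : ℕ
  k = length level0

  -- With the counter already equal to n (0-based, i.e. the new counter is
  -- 𝔫 = n+1), choose the φ_k^{-1}(𝔫)-th arrow among those starting at level 0.
  pick0 : ℕ → Maybe (Fin N)
  pick0 n with n ℕ.<? k
  ... | yes n<k = just (lookup level0 (φ k ⟨$⟩ˡ Fin.fromℕ< n<k))
  ... | no _    = nothing

  pickRight : ℤ → List (Fin N) → Maybe (Fin N)
  pickRight lvl lab =
    last (filter (λ j → ((+ rank (T j)) ℤ.≟ lvl) ×-dec ¬? (j ∈? lab)) (allFin N))

  -- run fuel level counter labelled : the labelled arrows A_{π(1)},...,A_{π(i)}
  -- in order, when the loop stops (either no arrow found, or all N labelled).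
  run : ℕ → ℤ → ℕ → List (Fin N) → List (Fin N)
  run zero lvl n lab = lab
  run (suc fuel) lvl n lab with lvl ℤ.≟ 0ℤ
  ... | yes _ with pick0 n
  ...   | nothing = lab
  ...   | just j  = run fuel (endRank (T j)) (suc n) (lab ++ [ j ])
  run (suc fuel) lvl n lab | no _ with pickRight lvl lab
  ...   | nothing = lab
  ...   | just j  = run fuel (endRank (T j)) n (lab ++ [ j ])

  labelled : List (Fin N)
  labelled = run N 0ℤ 0 []

  -- the arrows left unlabelled (at their current ranks, i.e. those of T)
  unlabelled : List (Fin N)
  unlabelled = filter (λ j → ¬? (j ∈? labelled)) (allFin N)

-- Writing [a ≤ j] for the indicator of a ≤ j, an arrow from level r to level e contributes
-- [r ≤ j] − [e ≤ j] to row j, whatever its colour.  Step 2 labels a chain of arrows, each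
-- starting where the previous one ended, so the row counts of a chain from level 0 to level
-- l telescope to [0 ≤ j] − [l ≤ j].  Suppose the run gets stuck at a level l ≠ 0, i.e. every
-- arrow starting at l is labelled.  For the unlabelled arrows, row l then carries no more
-- than row l − 1 (only arrows starting at l could add to it), while balance of T forces row l
-- of the unlabelled arrows to exceed row l − 1 by one; so the run can only stop at level 0.
-- A chain from 0 back to 0 is balanced, its partial sums are start levels and hence ≥ 0, and
-- the unlabelled arrows are balanced as the difference of two balanced collections.

module Submission where

open import Defs
open import Data.Bool using (true; false; if_then_else_; _∧_)
open import Data.Empty using (⊥-elim)
open import Data.Fin as Fin using (Fin)
import Data.Fin.Properties as Finₚ
open import Data.Fin.Permutation using (Permutation′; _⟨$⟩ˡ_; _⟨$⟩ʳ_; inverseʳ)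
open import Data.Integer as ℤ using (ℤ; +_; 0ℤ; 1ℤ; -1ℤ; _+_; _-_; _≤_; _≤?_; +≤+)
import Data.Integer.Properties as ℤₚ
open import Data.Integer.Tactic.RingSolver using (solve-∀)
open import Data.List using (List; []; _∷_; _++_; [_]; _∷ʳ_; map; filter; length; lookup; last; take; allFin)
import Data.List.Properties as Listₚ
open import Data.List.Membership.Propositional using (_∈_; _∉_)
import Data.List.Membership.Propositional.Properties as ∈ₚ
import Data.List.Membership.DecPropositional as DecMembership
open import Data.List.Relation.Unary.All as All using (All; []; _∷_)
open import Data.List.Relation.Unary.Any using (here; there)
open import Data.List.Relation.Unary.Unique.Propositional using (Unique)
open import Data.List.Relation.Unary.AllPairs using ([]; _∷_)
import Data.List.Relation.Unary.Unique.Propositional.Properties as Uniqueₚ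
open import Data.Maybe using (just; nothing)
import Data.Maybe.Properties as Maybeₚ
open import Data.Nat as ℕ using (ℕ; zero; suc; _<_; z≤n; s≤s)
import Data.Nat.Properties as ℕₚ
open import Data.Product using (Σ; ∃-syntax; _×_; _,_; proj₂)
open import Data.Sum using (inj₁; inj₂)
open import Function using (_∘_)
open import Relation.Nullary using (¬_; does; yes; no; ¬?; _×-dec_)
open import Relation.Unary using (Decidable)
open import Relation.Binary.PropositionalEquality hiding ([_])

pred≡-1 : ∀ y → ℤ.pred y ≡ y - 1ℤ
pred≡-1 y = ℤₚ.+-comm -1ℤ y

<⇒≤-1 : ∀ {x y} → x ℤ.< y → x ≤ y - 1ℤ
<⇒≤-1 {x} {y} x<y = subst (x ≤_) (pred≡-1 y) (ℤₚ.i<j⇒i≤pred[j] x<y)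

≤-1⇒< : ∀ {x y} → x ≤ y - 1ℤ → x ℤ.< y
≤-1⇒< {x} {y} x≤y-1 = ℤₚ.i≤pred[j]⇒i<j (subst (x ≤_) (sym (pred≡-1 y)) x≤y-1)

≰-1⇒≥ : ∀ {x y} → ¬ (x ≤ y - 1ℤ) → y ≤ x
≰-1⇒≥ x≰y-1 = ℤₚ.≮⇒≥ (x≰y-1 ∘ <⇒≤-1)

i<i+j : ∀ i {j} → 0ℤ ℤ.< j → i ℤ.< i + j
i<i+j i 0<j = subst (ℤ._< i + _) (ℤₚ.+-identityʳ i) (ℤₚ.+-monoʳ-< i 0<j)

i+j<i : ∀ i {j} → j ℤ.< 0ℤ → i + j ℤ.< i
i+j<i i j<0 = subst (i + _ ℤ.<_) (ℤₚ.+-identityʳ i) (ℤₚ.+-monoʳ-< i j<0)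

-- Row contributions

𝟙≤ : ℤ → ℤ → ℤ
𝟙≤ a j = if does (a ≤? j) then 1ℤ else 0ℤ

𝟙≤-refl : ∀ l → 𝟙≤ l l ≡ 1ℤ
𝟙≤-refl l with l ≤? l
... | yes _ = refl
... | no l≰l = ⊥-elim (l≰l ℤₚ.≤-refl)

𝟙≤-pred-self : ∀ l → 𝟙≤ l (l - 1ℤ) ≡ 0ℤ
𝟙≤-pred-self l with l ≤? l - 1ℤ
... | yes l≤l-1 = ⊥-elim (ℤₚ.<-irrefl refl (≤-1⇒< l≤l-1))
... | no _ = refl

𝟙≤-pred : ∀ a l → a ≢ l → 𝟙≤ a (l - 1ℤ) ≡ 𝟙≤ a l
𝟙≤-pred a l a≢l with a ≤? l - 1ℤ | a ≤? l
... | yes _ | yes _ = refl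
... | no _ | no _ = refl
... | yes a≤l-1 | no a≰l = ⊥-elim (a≰l (ℤₚ.<⇒≤ (≤-1⇒< a≤l-1)))
... | no a≰l-1 | yes a≤l = ⊥-elim (a≢l (ℤₚ.≤-antisym a≤l (≰-1⇒≥ a≰l-1)))

𝟙≤-pred-≤ : ∀ a l → 𝟙≤ a (l - 1ℤ) ≤ 𝟙≤ a l
𝟙≤-pred-≤ a l with a ≤? l - 1ℤ | a ≤? l
... | yes _ | yes _ = ℤₚ.≤-refl
... | yes a≤l-1 | no a≰l = ⊥-elim (a≰l (ℤₚ.<⇒≤ (≤-1⇒< a≤l-1)))
... | no _ | yes _ = +≤+ z≤n
... | no _ | no _ = ℤₚ.≤-refl

red-contribution : ∀ r b j → 0ℤ ℤ.< b →
  (if does (r ≤? j) ∧ does (j ≤? r + b - 1ℤ) then 1ℤ else 0ℤ) ≡ 𝟙≤ r j - 𝟙≤ (r + b) j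
red-contribution r b j 0<b with r ≤? j | j ≤? r + b - 1ℤ | r + b ≤? j
... | yes _ | yes j≤e-1 | yes e≤j = ⊥-elim (ℤₚ.<⇒≱ (≤-1⇒< j≤e-1) e≤j)
... | yes _ | yes _ | no _ = refl
... | yes _ | no _ | yes _ = refl
... | yes _ | no j≰e-1 | no e≰j = ⊥-elim (e≰j (≰-1⇒≥ j≰e-1))
... | no r≰j | _ | yes e≤j = ⊥-elim (r≰j (ℤₚ.<⇒≤ (ℤₚ.<-≤-trans (i<i+j r 0<b) e≤j)))
... | no _ | _ | no _ = refl

blue-contribution : ∀ r b j → b ℤ.< 0ℤ →
  (if does (r + b ≤? j) ∧ does (j ≤? r - 1ℤ) then -1ℤ else 0ℤ) ≡ 𝟙≤ r j - 𝟙≤ (r + b) j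
blue-contribution r b j b<0 with r + b ≤? j | j ≤? r - 1ℤ | r ≤? j
... | yes _ | yes j≤r-1 | yes r≤j = ⊥-elim (ℤₚ.<⇒≱ (≤-1⇒< j≤r-1) r≤j)
... | yes _ | yes _ | no _ = refl
... | yes _ | no _ | yes _ = refl
... | yes _ | no j≰r-1 | no r≰j = ⊥-elim (r≰j (≰-1⇒≥ j≰r-1))
... | no e≰j | _ | yes r≤j = ⊥-elim (e≰j (ℤₚ.<⇒≤ (ℤₚ.<-≤-trans (i+j<i r b<0) r≤j)))
... | no _ | _ | no _ = refl

rowContribution≡𝟙≤-𝟙≤ : ∀ a j → rowContribution a j ≡ 𝟙≤ (+ rank a) j - 𝟙≤ (endRank a) j
rowContribution≡𝟙≤-𝟙≤ a j with 0ℤ ℤ.<? step a | step a ℤ.<? 0ℤ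
... | yes 0<b | yes b<0 = ⊥-elim (ℤₚ.<-asym 0<b b<0)
... | yes 0<b | no _ = red-contribution (+ rank a) (step a) j 0<b
... | no _ | yes b<0 = blue-contribution (+ rank a) (step a) j b<0
... | no 0≮b | no b≮0 with ℤₚ.≤-antisym (ℤₚ.≮⇒≥ b≮0) (ℤₚ.≮⇒≥ 0≮b)
...   | refl rewrite ℤₚ.+-identityʳ (+ rank a) = sym (ℤₚ.+-inverseʳ (𝟙≤ (+ rank a) j))

sumOf : ∀ {A : Set} → (A → ℤ) → List A → ℤ
sumOf g xs = sumℤ (map g xs)

restrict : ∀ {A : Set} {P : A → Set} → Decidable P → (A → ℤ) → A → ℤ
restrict P? g x = if does (P? x) then g x else 0ℤ

module _ {A : Set} where

  sumOf-++ : ∀ (g : A → ℤ) xs ys → sumOf g (xs ++ ys) ≡ sumOf g xs + sumOf g ys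
  sumOf-++ g [] ys = sym (ℤₚ.+-identityˡ (sumOf g ys))
  sumOf-++ g (x ∷ xs) ys = begin
    g x + sumOf g (xs ++ ys)          ≡⟨ cong (_+_ (g x)) (sumOf-++ g xs ys) ⟩
    g x + (sumOf g xs + sumOf g ys)   ≡⟨ ℤₚ.+-assoc (g x) (sumOf g xs) (sumOf g ys) ⟨
    g x + sumOf g xs + sumOf g ys     ∎
    where open ≡-Reasoning

  sumOf-0 : ∀ (xs : List A) → sumOf (λ _ → 0ℤ) xs ≡ 0ℤ
  sumOf-0 [] = refl
  sumOf-0 (x ∷ xs) = trans (ℤₚ.+-identityˡ _) (sumOf-0 xs)

  sumOf-cong : ∀ {f h : A → ℤ} xs → (∀ x → f x ≡ h x) → sumOf f xs ≡ sumOf h xs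
  sumOf-cong [] f≗h = refl
  sumOf-cong (x ∷ xs) f≗h = cong₂ _+_ (f≗h x) (sumOf-cong xs f≗h)

  sumOf-+ : ∀ (f h : A → ℤ) xs → sumOf (λ x → f x + h x) xs ≡ sumOf f xs + sumOf h xs
  sumOf-+ f h [] = refl
  sumOf-+ f h (x ∷ xs) = begin
    f x + h x + sumOf (λ x → f x + h x) xs   ≡⟨ cong (_+_ (f x + h x)) (sumOf-+ f h xs) ⟩
    f x + h x + (sumOf f xs + sumOf h xs)    ≡⟨ interchange (f x) (h x) (sumOf f xs) (sumOf h xs) ⟩
    f x + sumOf f xs + (h x + sumOf h xs)    ∎
    where
    open ≡-Reasoning
    interchange : ∀ a b c d → a + b + (c + d) ≡ a + c + (b + d)
    interchange = solve-∀

  sumOf-mono : ∀ {f h : A → ℤ} xs → All (λ x → f x ≤ h x) xs → sumOf f xs ≤ sumOf h xs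
  sumOf-mono [] [] = ℤₚ.≤-refl
  sumOf-mono (x ∷ xs) (fx≤hx ∷ f≤h) = ℤₚ.+-mono-≤ fx≤hx (sumOf-mono xs f≤h)

  sumOf-filter : ∀ {P : A → Set} (P? : Decidable P) g xs →
    sumOf g (filter P? xs) ≡ sumOf (restrict P? g) xs
  sumOf-filter P? g [] = refl
  sumOf-filter P? g (x ∷ xs) with does (P? x)
  ... | true = cong (_+_ (g x)) (sumOf-filter P? g xs)
  ... | false = trans (sumOf-filter P? g xs) (sym (ℤₚ.+-identityˡ _))

sumOf-allFin-suc : ∀ {n} (g : Fin (suc n) → ℤ) →
  sumOf g (allFin (suc n)) ≡ g Fin.zero + sumOf (g ∘ Fin.suc) (allFin n)
sumOf-allFin-suc g = cong (λ xs → g Fin.zero + sumℤ xs)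
  (trans (Listₚ.map-tabulate Fin.suc g) (sym (Listₚ.map-tabulate (λ i → i) (g ∘ Fin.suc))))

sumOf-allFin-restrict-≟ : ∀ {n} (y : Fin n) (g : Fin n → ℤ) →
  sumOf (restrict (Fin._≟ y) g) (allFin n) ≡ g y
sumOf-allFin-restrict-≟ {suc n} Fin.zero g = begin
  sumOf (restrict (Fin._≟ Fin.zero) g) (allFin (suc n))  ≡⟨ sumOf-allFin-suc (restrict (Fin._≟ Fin.zero) g) ⟩
  g Fin.zero + sumOf (λ _ → 0ℤ) (allFin n)               ≡⟨ cong (_+_ (g Fin.zero)) (sumOf-0 (allFin n)) ⟩
  g Fin.zero + 0ℤ                                        ≡⟨ ℤₚ.+-identityʳ (g Fin.zero) ⟩
  g Fin.zero                                             ∎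
  where open ≡-Reasoning
sumOf-allFin-restrict-≟ {suc n} (Fin.suc y) g = begin
  sumOf (restrict (Fin._≟ Fin.suc y) g) (allFin (suc n))  ≡⟨ sumOf-allFin-suc (restrict (Fin._≟ Fin.suc y) g) ⟩
  0ℤ + sumOf (restrict (Fin._≟ y) (g ∘ Fin.suc)) (allFin n) ≡⟨ ℤₚ.+-identityˡ _ ⟩
  sumOf (restrict (Fin._≟ y) (g ∘ Fin.suc)) (allFin n)      ≡⟨ sumOf-allFin-restrict-≟ y (g ∘ Fin.suc) ⟩
  g (Fin.suc y)                                             ∎
  where open ≡-Reasoning

module _ {N : ℕ} where

  open DecMembership (Fin._≟_ {N}) using (_∈?_)

  complement : List (Fin N) → List (Fin N)
  complement L = filter (λ j → ¬? (j ∈? L)) (allFin N)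

  sumOf-allFin-restrict-∈ : ∀ (g : Fin N → ℤ) L → Unique L →
    sumOf (restrict (_∈? L) g) (allFin N) ≡ sumOf g L
  sumOf-allFin-restrict-∈ g [] [] = sumOf-0 (allFin N)
  sumOf-allFin-restrict-∈ g (y ∷ L) (y∉L ∷ L!) = begin
    sumOf (restrict (_∈? y ∷ L) g) (allFin N)
      ≡⟨ sumOf-cong (allFin N) restrict-∷ ⟩
    sumOf (λ x → restrict (Fin._≟ y) g x + restrict (_∈? L) g x) (allFin N)
      ≡⟨ sumOf-+ _ _ (allFin N) ⟩
    sumOf (restrict (Fin._≟ y) g) (allFin N) + sumOf (restrict (_∈? L) g) (allFin N)
      ≡⟨ cong₂ _+_ (sumOf-allFin-restrict-≟ y g) (sumOf-allFin-restrict-∈ g L L!) ⟩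
    g y + sumOf g L
      ∎
    where
    open ≡-Reasoning
    restrict-∷ : ∀ x → restrict (_∈? y ∷ L) g x ≡ restrict (Fin._≟ y) g x + restrict (_∈? L) g x
    restrict-∷ x with x Fin.≟ y
    ... | no _ = sym (ℤₚ.+-identityˡ _)
    ... | yes refl with x ∈? L
    ...   | yes x∈L = ⊥-elim (All.lookup y∉L x∈L refl)
    ...   | no _ = sym (ℤₚ.+-identityʳ _)

  sumOf-allFin-partition : ∀ (g : Fin N → ℤ) L → Unique L →
    sumOf g (allFin N) ≡ sumOf g L + sumOf g (complement L)
  sumOf-allFin-partition g L L! = begin
    sumOf g (allFin N)
      ≡⟨ sumOf-cong (allFin N) restrict-∈-∉ ⟩
    sumOf (λ x → restrict (_∈? L) g x + restrict (λ j → ¬? (j ∈? L)) g x) (allFin N)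
      ≡⟨ sumOf-+ _ _ (allFin N) ⟩
    sumOf (restrict (_∈? L) g) (allFin N) + sumOf (restrict (λ j → ¬? (j ∈? L)) g) (allFin N)
      ≡⟨ cong₂ _+_ (sumOf-allFin-restrict-∈ g L L!) (sym (sumOf-filter (λ j → ¬? (j ∈? L)) g (allFin N))) ⟩
    sumOf g L + sumOf g (complement L)
      ∎
    where
    open ≡-Reasoning
    restrict-∈-∉ : ∀ x → g x ≡ restrict (_∈? L) g x + restrict (λ j → ¬? (j ∈? L)) g x
    restrict-∈-∉ x with x ∈? L
    ... | yes _ = sym (ℤₚ.+-identityʳ _)
    ... | no _ = sym (ℤₚ.+-identityˡ _)

module _ {A : Set} where

  take-++ˡ : ∀ m (xs ys : List A) → m ℕ.≤ length xs → take m (xs ++ ys) ≡ take m xs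
  take-++ˡ zero xs ys _ = refl
  take-++ˡ (suc m) (x ∷ xs) ys (s≤s m≤∣xs∣) = cong (x ∷_) (take-++ˡ m xs ys m≤∣xs∣)

  lookup-injective : ∀ (xs : List A) → Unique xs → ∀ i j → lookup xs i ≡ lookup xs j → i ≡ j
  lookup-injective (x ∷ xs) (x∉xs ∷ xs!) Fin.zero Fin.zero _ = refl
  lookup-injective (x ∷ xs) (x∉xs ∷ xs!) Fin.zero (Fin.suc j) x≡ = ⊥-elim (All.lookup x∉xs (∈ₚ.∈-lookup j) x≡)
  lookup-injective (x ∷ xs) (x∉xs ∷ xs!) (Fin.suc i) Fin.zero ≡x = ⊥-elim (All.lookup x∉xs (∈ₚ.∈-lookup i) (sym ≡x))
  lookup-injective (x ∷ xs) (x∉xs ∷ xs!) (Fin.suc i) (Fin.suc j) eq = cong Fin.suc (lookup-injective xs xs! i j eq)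

  last-∈ : ∀ (xs : List A) {x} → last xs ≡ just x → x ∈ xs
  last-∈ (y ∷ []) refl = here refl
  last-∈ (y ∷ z ∷ zs) eq = there (last-∈ (z ∷ zs) eq)

  ∈⇒last≢nothing : ∀ {xs : List A} {x} → x ∈ xs → last xs ≢ nothing
  ∈⇒last≢nothing {_ ∷ []} _ ()
  ∈⇒last≢nothing {_ ∷ y ∷ ys} _ eq = ∈⇒last≢nothing {y ∷ ys} (here refl) eq

  length-∷ʳ : ∀ (xs : List A) y → length (xs ∷ʳ y) ≡ suc (length xs)
  length-∷ʳ xs y = trans (Listₚ.length-++ xs) (ℕₚ.+-comm (length xs) 1)

  length-∷ʳ-+ : ∀ (xs : List A) y n → length (xs ∷ʳ y) ℕ.+ n ≡ length xs ℕ.+ suc n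
  length-∷ʳ-+ xs y n = trans (cong (ℕ._+ n) (length-∷ʳ xs y)) (sym (ℕₚ.+-suc (length xs) n))

  unique-∷ʳ : ∀ {xs : List A} {y} → Unique xs → y ∉ xs → Unique (xs ∷ʳ y)
  unique-∷ʳ xs! y∉xs = Uniqueₚ.++⁺ xs! ([] ∷ []) (λ { (y∈xs , here refl) → y∉xs y∈xs })

-- Chains of arrows

module _ {N : ℕ} (T : PathDiagram N) where

  open DecMembership (Fin._≟_ {N}) using (_∈?_)

  steps : List (Fin N) → List ℤ
  steps = map (λ j → step (T j))

  data Chain : ℤ → List (Fin N) → Set where
    []     : Chain 0ℤ []
    extend : ∀ {lvl L} → Chain lvl L → ∀ y → + rank (T y) ≡ lvl → Chain (endRank (T y)) (L ∷ʳ y)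

  chain-rowCount : ∀ {lvl L} → Chain lvl L → ∀ j → rowCount T L j ≡ 𝟙≤ 0ℤ j - 𝟙≤ lvl j
  chain-rowCount [] j = sym (ℤₚ.+-inverseʳ (𝟙≤ 0ℤ j))
  chain-rowCount (extend {L = L} c y refl) j = begin
    rowCount T (L ∷ʳ y) j
      ≡⟨ sumOf-++ (λ i → rowContribution (T i) j) L [ y ] ⟩
    rowCount T L j + (rowContribution (T y) j + 0ℤ)
      ≡⟨ cong₂ (λ u v → u + (v + 0ℤ)) (chain-rowCount c j) (rowContribution≡𝟙≤-𝟙≤ (T y) j) ⟩
    𝟙≤ 0ℤ j - 𝟙≤ r j + (𝟙≤ r j - 𝟙≤ e j + 0ℤ)
      ≡⟨ telescope (𝟙≤ 0ℤ j) (𝟙≤ r j) (𝟙≤ e j) ⟩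
    𝟙≤ 0ℤ j - 𝟙≤ e j
      ∎
    where
    open ≡-Reasoning
    r e : ℤ
    r = + rank (T y)
    e = endRank (T y)
    telescope : ∀ a b c → a - b + (b - c + 0ℤ) ≡ a - c
    telescope = solve-∀

  chain-sum : ∀ {lvl L} → Chain lvl L → sumℤ (steps L) ≡ lvl
  chain-sum [] = refl
  chain-sum (extend {L = L} c y refl) = begin
    sumℤ (steps (L ∷ʳ y))                ≡⟨ sumOf-++ (λ j → step (T j)) L [ y ] ⟩
    sumℤ (steps L) + (step (T y) + 0ℤ)   ≡⟨ cong₂ _+_ (chain-sum c) (ℤₚ.+-identityʳ (step (T y))) ⟩
    endRank (T y)                        ∎
    where open ≡-Reasoning

  take-steps-∷ʳ : ∀ L y {m} → m ℕ.≤ length L → take m (steps (L ∷ʳ y)) ≡ take m (steps L)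
  take-steps-∷ʳ L y {m} m≤∣L∣ = begin
    take m (steps (L ∷ʳ y))          ≡⟨ cong (take m) (Listₚ.map-++ (λ j → step (T j)) L [ y ]) ⟩
    take m (steps L ∷ʳ step (T y))   ≡⟨ take-++ˡ m (steps L) _ (subst (m ℕ.≤_) (sym (Listₚ.length-map _ L)) m≤∣L∣) ⟩
    take m (steps L)                 ∎
    where open ≡-Reasoning

  -- Each proper partial sum is the start level of the next arrow, a natural number.
  chain-prefix-nonneg : ∀ {lvl L} → Chain lvl L → ∀ m → m < length L → 0ℤ ≤ sumℤ (take m (steps L))
  chain-prefix-nonneg (extend {lvl} {L} c y r≡lvl) m m<∣L∷ʳy∣
    with ℕₚ.m<1+n⇒m<n∨m≡n (subst (m <_) (length-∷ʳ L y) m<∣L∷ʳy∣)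
  ... | inj₁ m<∣L∣ = subst (0ℤ ≤_) (cong sumℤ (sym (take-steps-∷ʳ L y (ℕₚ.<⇒≤ m<∣L∣)))) (chain-prefix-nonneg c m m<∣L∣)
  ... | inj₂ refl = subst (0ℤ ≤_) (sym start-level) (+≤+ z≤n)
    where
    start-level : sumℤ (take (length L) (steps (L ∷ʳ y))) ≡ + rank (T y)
    start-level = begin
      sumℤ (take (length L) (steps (L ∷ʳ y)))
        ≡⟨ cong sumℤ (take-steps-∷ʳ L y ℕₚ.≤-refl) ⟩
      sumℤ (take (length L) (steps L))
        ≡⟨ cong sumℤ (Listₚ.take-all _ (steps L) (ℕₚ.≤-reflexive (Listₚ.length-map _ L))) ⟩
      sumℤ (steps L)
        ≡⟨ chain-sum c ⟩
      lvl
        ≡⟨ r≡lvl ⟨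
      + rank (T y)
        ∎
      where open ≡-Reasoning

  closed-chain-balanced : ∀ {L} → Chain 0ℤ L → BalancedOn T L
  closed-chain-balanced c j = trans (chain-rowCount c j) (ℤₚ.+-inverseʳ (𝟙≤ 0ℤ j))

  closed-chain-generalDyck : ∀ {L} → Chain 0ℤ L → GeneralDyck (steps L)
  closed-chain-generalDyck {L} c = chain-sum c , prefix
    where
    prefix : ∀ m → 0ℤ ≤ sumℤ (take m (steps L))
    prefix m with m ℕ.<? length L
    ... | yes m<∣L∣ = chain-prefix-nonneg c m m<∣L∣
    ... | no m≮∣L∣
      rewrite Listₚ.take-all m (steps L) (ℕₚ.≤-trans (ℕₚ.≤-reflexive (Listₚ.length-map _ L)) (ℕₚ.≮⇒≥ m≮∣L∣))
            | chain-sum c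
      = ℤₚ.≤-refl

  rowCount-≤-pred : ∀ l S → (∀ x → x ∈ S → + rank (T x) ≢ l) → rowCount T S l ≤ rowCount T S (l - 1ℤ)
  rowCount-≤-pred l S noneStartAt-l = sumOf-mono S (All.tabulate (λ {x} x∈S → drop x (noneStartAt-l x x∈S)))
    where
    drop : ∀ x → + rank (T x) ≢ l → rowContribution (T x) l ≤ rowContribution (T x) (l - 1ℤ)
    drop x r≢l
      rewrite rowContribution≡𝟙≤-𝟙≤ (T x) l | rowContribution≡𝟙≤-𝟙≤ (T x) (l - 1ℤ)
            | 𝟙≤-pred (+ rank (T x)) l r≢l
      = ℤₚ.+-monoʳ-≤ (𝟙≤ (+ rank (T x)) l) (ℤₚ.neg-mono-≤ (𝟙≤-pred-≤ (endRank (T x)) l))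

  rowCount-complement : Balanced T → ∀ {L} → Unique L → ∀ j → rowCount T L j + rowCount T (complement L) j ≡ 0ℤ
  rowCount-complement bal {L} L! j = trans (sym (sumOf-allFin-partition (λ i → rowContribution (T i) j) L L!)) (bal j)

  complement-balanced : Balanced T → ∀ {L} → Unique L → BalancedOn T L → BalancedOn T (complement L)
  complement-balanced bal {L} L! balL j = begin
    rowCount T (complement L) j                     ≡⟨ ℤₚ.+-identityˡ _ ⟨
    0ℤ + rowCount T (complement L) j                ≡⟨ cong (λ u → u + rowCount T (complement L) j) (balL j) ⟨
    rowCount T L j + rowCount T (complement L) j    ≡⟨ rowCount-complement bal L! j ⟩
    0ℤ                                              ∎
    where open ≡-Reasoning

  exhausted-chain-ends-at-0 : ∀ {lvl L} → Balanced T → Chain lvl L → Unique L →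
    (∀ x → + rank (T x) ≡ lvl → x ∈ L) → lvl ≡ 0ℤ
  exhausted-chain-ends-at-0 {l} {L} bal c L! exhausted with l ℤ.≟ 0ℤ
  ... | yes l≡0 = l≡0
  ... | no l≢0 = ⊥-elim (ℤₚ.<⇒≱ (gap {c₀} at-l at-l-1) (rowCount-≤-pred l (complement L) noneStartAt-l))
    where
    R : ℤ → ℤ
    R = rowCount T (complement L)
    c₀ : ℤ
    c₀ = 𝟙≤ 0ℤ l
    noneStartAt-l : ∀ x → x ∈ complement L → + rank (T x) ≢ l
    noneStartAt-l x x∈R r≡l = proj₂ (∈ₚ.∈-filter⁻ (λ j → ¬? (j ∈? L)) {xs = allFin N} x∈R) (exhausted x r≡l)
    at-l : c₀ - 1ℤ + R l ≡ 0ℤ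
    at-l = trans (cong (λ u → u + R l) (trans (cong (c₀ -_) (sym (𝟙≤-refl l))) (sym (chain-rowCount c l))))
                 (rowCount-complement bal L! l)
    at-l-1 : c₀ - 0ℤ + R (l - 1ℤ) ≡ 0ℤ
    at-l-1 = trans (cong (λ u → u + R (l - 1ℤ))
                     (trans (cong₂ _-_ (sym (𝟙≤-pred 0ℤ l (l≢0 ∘ sym))) (sym (𝟙≤-pred-self l)))
                            (sym (chain-rowCount c (l - 1ℤ)))))
                   (rowCount-complement bal L! (l - 1ℤ))
    gap : ∀ {c a b} → c - 1ℤ + a ≡ 0ℤ → c - 0ℤ + b ≡ 0ℤ → b ℤ.< a
    gap {c} {a} {b} eₐ e_b = ℤₚ.suc[i]≤j⇒i<j (ℤₚ.≤-reflexive (begin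
      1ℤ + b                        ≡⟨ ℤₚ.+-identityʳ (1ℤ + b) ⟨
      1ℤ + b + 0ℤ                   ≡⟨ cong (_+_ (1ℤ + b)) eₐ ⟨
      1ℤ + b + (c - 1ℤ + a)         ≡⟨ rearrange c a b ⟩
      a + (c - 0ℤ + b)              ≡⟨ cong (_+_ a) e_b ⟩
      a + 0ℤ                        ≡⟨ ℤₚ.+-identityʳ a ⟩
      a                             ∎))
      where
      open ≡-Reasoning
      rearrange : ∀ c a b → 1ℤ + b + (c - 1ℤ + a) ≡ a + (c - 0ℤ + b)
      rearrange = solve-∀

-- Step 2 of the algorithm

module _ {N : ℕ} (T : PathDiagram N) (φ : (k : ℕ) → Permutation′ k) where

  open Step2 T φ
  open DecMembership (Fin._≟_ {N}) using (_∈?_)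

  pick0-lookup : ∀ {n x} → pick0 n ≡ just x → Σ (n < k) λ n<k → lookup level0 (φ k ⟨$⟩ˡ Fin.fromℕ< n<k) ≡ x
  pick0-lookup {n} eq with n ℕ.<? k
  ... | yes n<k = n<k , Maybeₚ.just-injective eq
  ... | no _ with eq
  ...   | ()

  pick0-rank : ∀ {n x} → pick0 n ≡ just x → rank (T x) ≡ 0
  pick0-rank eq with pick0-lookup eq
  ... | _ , refl = proj₂ (∈ₚ.∈-filter⁻ (λ j → rank (T j) ℕ.≟ 0) {xs = allFin N} (∈ₚ.∈-lookup _))

  pick0-injective : ∀ {m n x} → pick0 m ≡ just x → pick0 n ≡ just x → m ≡ n
  pick0-injective {m} {n} eqₘ eqₙ with pick0-lookup eqₘ | pick0-lookup eqₙ
  ... | m<k , xₘ | n<k , xₙ = Finₚ.fromℕ<-injective m n m<k n<k (begin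
    Fin.fromℕ< m<k                              ≡⟨ inverseʳ (φ k) ⟨
    φ k ⟨$⟩ʳ (φ k ⟨$⟩ˡ Fin.fromℕ< m<k)          ≡⟨ cong (φ k ⟨$⟩ʳ_) same-position ⟩
    φ k ⟨$⟩ʳ (φ k ⟨$⟩ˡ Fin.fromℕ< n<k)          ≡⟨ inverseʳ (φ k) ⟩
    Fin.fromℕ< n<k                              ∎)
    where
    open ≡-Reasoning
    level0-unique : Unique level0
    level0-unique = Uniqueₚ.filter⁺ (λ j → rank (T j) ℕ.≟ 0) (Uniqueₚ.allFin⁺ N)
    same-position : φ k ⟨$⟩ˡ Fin.fromℕ< m<k ≡ φ k ⟨$⟩ˡ Fin.fromℕ< n<k
    same-position = lookup-injective level0 level0-unique _ _ (trans xₘ (sym xₙ))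

  pickRight-just : ∀ {lvl L x} → pickRight lvl L ≡ just x → + rank (T x) ≡ lvl × x ∉ L
  pickRight-just {lvl} {L} eq =
    proj₂ (∈ₚ.∈-filter⁻ (λ j → (+ rank (T j) ℤ.≟ lvl) ×-dec ¬? (j ∈? L)) {xs = allFin N} (last-∈ _ eq))

  pickRight-nothing : ∀ {lvl L} → pickRight lvl L ≡ nothing → ∀ x → + rank (T x) ≡ lvl → x ∈ L
  pickRight-nothing {lvl} {L} eq x r≡lvl with x ∈? L
  ... | yes x∈L = x∈L
  ... | no x∉L = ⊥-elim (∈⇒last≢nothing
          (∈ₚ.∈-filter⁺ (λ j → (+ rank (T j) ℤ.≟ lvl) ×-dec ¬? (j ∈? L)) (∈ₚ.∈-allFin x) (r≡lvl , x∉L)) eq)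

  -- Level-0 arrows are labelled only through pick0, so a labelled level-0 arrow was drawn
  -- with an earlier counter; injectivity of pick0 then keeps every new draw unlabelled.
  record Labelling (lvl : ℤ) (n : ℕ) (L : List (Fin N)) : Set where
    field
      chain        : Chain T lvl L
      unique       : Unique L
      level0-drawn : ∀ x → x ∈ L → rank (T x) ≡ 0 → ∃[ m ] m < n × pick0 m ≡ just x
  open Labelling

  extend-at-0 : ∀ {n L y} → Labelling 0ℤ n L → pick0 n ≡ just y → Labelling (endRank (T y)) (suc n) (L ∷ʳ y)
  extend-at-0 {n} {L} {y} inv eq = record
    { chain        = extend (chain inv) y (cong +_ (pick0-rank eq))
    ; unique       = unique-∷ʳ (unique inv) y∉L
    ; level0-drawn = drawn
    }
    where
    y∉L : y ∉ L
    y∉L y∈L with level0-drawn inv y y∈L (pick0-rank eq)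
    ... | m , m<n , eqₘ = ℕₚ.<-irrefl (pick0-injective eqₘ eq) m<n
    drawn : ∀ x → x ∈ L ∷ʳ y → rank (T x) ≡ 0 → ∃[ m ] m < suc n × pick0 m ≡ just x
    drawn x x∈ r≡0 with ∈ₚ.∈-++⁻ L x∈
    ... | inj₁ x∈L with level0-drawn inv x x∈L r≡0
    ...   | m , m<n , eqₘ = m , ℕₚ.m<n⇒m<1+n m<n , eqₘ
    drawn x _ _ | inj₂ (here refl) = n , ℕₚ.n<1+n n , eq

  extend-right : ∀ {lvl n L y} → Labelling lvl n L → lvl ≢ 0ℤ → pickRight lvl L ≡ just y →
    Labelling (endRank (T y)) n (L ∷ʳ y)
  extend-right {n = n} {L} {y} inv lvl≢0 eq with pickRight-just eq
  ... | r≡lvl , y∉L = record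
    { chain        = extend (chain inv) y r≡lvl
    ; unique       = unique-∷ʳ (unique inv) y∉L
    ; level0-drawn = drawn
    }
    where
    drawn : ∀ x → x ∈ L ∷ʳ y → rank (T x) ≡ 0 → ∃[ m ] m < n × pick0 m ≡ just x
    drawn x x∈ r≡0 with ∈ₚ.∈-++⁻ L x∈
    ... | inj₁ x∈L = level0-drawn inv x x∈L r≡0
    ... | inj₂ (here refl) = ⊥-elim (lvl≢0 (trans (sym r≡lvl) (cong +_ r≡0)))

  run-halts-at-0 : Balanced T → ∀ fuel {lvl n L} → Labelling lvl n L → length L ℕ.+ fuel ≡ N →
    length (run fuel lvl n L) < N → Chain T 0ℤ (run fuel lvl n L) × Unique (run fuel lvl n L)
  run-halts-at-0 bal zero {L = L} _ e early =
    ⊥-elim (ℕₚ.<-irrefl (trans (sym (ℕₚ.+-identityʳ (length L))) e) early)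
  run-halts-at-0 bal (suc fuel) {lvl} {n} {L} inv e early with lvl ℤ.≟ 0ℤ
  ... | yes refl with pick0 n in eq
  ...   | nothing = chain inv , unique inv
  ...   | just y  = run-halts-at-0 bal fuel (extend-at-0 inv eq) (trans (length-∷ʳ-+ L y fuel) e) early
  run-halts-at-0 bal (suc fuel) {lvl} {n} {L} inv e early | no lvl≢0 with pickRight lvl L in eq
  ... | nothing = ⊥-elim (lvl≢0 (exhausted-chain-ends-at-0 T bal (chain inv) (unique inv) (pickRight-nothing eq)))
  ... | just y  = run-halts-at-0 bal fuel (extend-right inv lvl≢0 eq) (trans (length-∷ʳ-+ L y fuel) e) early

  labelled-closed-chain : Balanced T → length labelled < N → Chain T 0ℤ labelled × Unique labelled
  labelled-closed-chain bal = run-halts-at-0 bal N start refl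
    where
    start : Labelling 0ℤ 0 []
    start = record { chain = [] ; unique = [] ; level0-drawn = λ _ () }

lemma2 : (N : ℕ) (T : PathDiagram N) (φ : (k : ℕ) → Permutation′ k) →
    Increasing T → Balanced T →
    length (Step2.labelled T φ) < N →
    GeneralDyck (map (λ j → step (T j)) (Step2.labelled T φ))
      × BalancedOn T (Step2.labelled T φ)
      × BalancedOn T (Step2.unlabelled T φ)
lemma2 N T φ _ bal early with labelled-closed-chain T φ bal early
... | closed , labelled-unique =
  closed-chain-generalDyck T closed , labelled-balanced , complement-balanced T bal labelled-unique labelled-balanced
  where
  labelled-balanced : BalancedOn T (Step2.labelled T φ)
  labelled-balanced = closed-chain-balanced T closed
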